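{- Let $\mathcal{K}$ be a 2-category, $\mathcal{C}$ a 0-cell, $T:\mathcal{C}\to\mathcal{C}$ a 1-cell, and $\mu:T^2\Rightarrow T$, $\eta:I\Rightarrow T$ 2-cells, where $I$ is the identity 1-cell on $\mathcal{C}$. The following are equivalent: (1) $\mu\circ\mu T=\mu\circ T\mu$ and $\mu\circ\eta T=\mu\circ T\eta=\mathrm{id}_T$; (2) $T$ is a terminal object in the rewrite category with objects all strings $T^n$ ($n\ge 0$, with $T^0=I$ the empty string) and rewrite rules $\mu$ and $\eta$; that is, for every $n\ge 0$ there exists a derivation from $T^n$ to $T$, and any two derivations from $T^n$ to $T$ have the same value.
   Context: Juxtaposition of 1-cells denotes composition, $\circ$ denotes vertical composition of 2-cells, and for 1-cells $A,B$ and a 2-cell $\phi:F\Rightarrow G$, $A\phi B:AFB\Rightarrow AGB$ denotes the whiskering of $\phi$ by the identity 2-cells on $A$ and $B$. Objects of the rewrite category are formal strings over the letter $T$. A reduction replaces an occurrence of the left side of a rule inside a string by its right side: either $T^aT^2T^b\to T^aTT^b$ with 2-cell $T^a\mu T^b$, or $T^aT^b\to T^aTT^b$ (inserting a $T$ at any position) with 2-cell $T^a\eta T^b$, for $a,b\geq 0$. A derivation from one string to another is a finite (possibly empty) sequence of reductions; its value is the vertical composite in $\mathcal{K}$ of the 2-cells of its reductions (identity for the empty derivation). Morphisms of the rewrite category are values of derivations. -}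

module Defs where

open import Level using (Level; _⊔_) renaming (suc to lsuc)
open import Data.Nat using (ℕ; zero; suc; _+_)
open import Data.Product using (Σ; _×_; _,_)
open import Relation.Binary.PropositionalEquality
  using (_≡_; refl; sym; trans; cong; cong₂; subst; subst₂)

-- Strict 2-categories (1-cells and 2-cells form sets; equalities are ≡).
-- f ⊚ g is the composite 1-cell written "fg" in the paper (first g, then f).

record Strict2Category (o h c : Level) : Set (lsuc (o ⊔ h ⊔ c)) where
  infixr 9 _⊚_
  infixr 9 _∘ᵥ_
  infixr 10 _∘ₕ_
  field
    Obj   : Set o
    _⇒₁_  : Obj → Obj → Set h
    _⇒₂_  : {A B : Obj} → A ⇒₁ B → A ⇒₁ B → Set c
    id₁   : {A : Obj} → A ⇒₁ A
    _⊚_   : {A B C : Obj} → B ⇒₁ C → A ⇒₁ B → A ⇒₁ C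
    ⊚-assoc : {A B C D : Obj} {f : C ⇒₁ D} {g : B ⇒₁ C} {k : A ⇒₁ B} →
              (f ⊚ g) ⊚ k ≡ f ⊚ (g ⊚ k)
    ⊚-idˡ : {A B : Obj} {f : A ⇒₁ B} → id₁ ⊚ f ≡ f
    ⊚-idʳ : {A B : Obj} {f : A ⇒₁ B} → f ⊚ id₁ ≡ f
    id₂   : {A B : Obj} {f : A ⇒₁ B} → f ⇒₂ f
    _∘ᵥ_  : {A B : Obj} {f g k : A ⇒₁ B} → g ⇒₂ k → f ⇒₂ g → f ⇒₂ k
    ∘ᵥ-assoc : {A B : Obj} {f g k l : A ⇒₁ B}
               {α : k ⇒₂ l} {β : g ⇒₂ k} {γ : f ⇒₂ g} →
               (α ∘ᵥ β) ∘ᵥ γ ≡ α ∘ᵥ (β ∘ᵥ γ)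
    ∘ᵥ-idˡ : {A B : Obj} {f g : A ⇒₁ B} {α : f ⇒₂ g} → id₂ ∘ᵥ α ≡ α
    ∘ᵥ-idʳ : {A B : Obj} {f g : A ⇒₁ B} {α : f ⇒₂ g} → α ∘ᵥ id₂ ≡ α
    _∘ₕ_  : {A B C : Obj} {f f′ : B ⇒₁ C} {g g′ : A ⇒₁ B} →
            f ⇒₂ f′ → g ⇒₂ g′ → (f ⊚ g) ⇒₂ (f′ ⊚ g′)
    ∘ₕ-id : {A B C : Obj} {f : B ⇒₁ C} {g : A ⇒₁ B} →
            id₂ {f = f} ∘ₕ id₂ {f = g} ≡ id₂
    interchange : {A B C : Obj} {f f′ f″ : B ⇒₁ C} {g g′ g″ : A ⇒₁ B}
                  {α : f ⇒₂ f′} {α′ : f′ ⇒₂ f″} {β : g ⇒₂ g′} {β′ : g′ ⇒₂ g″} →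
                  (α′ ∘ᵥ α) ∘ₕ (β′ ∘ᵥ β) ≡ (α′ ∘ₕ β′) ∘ᵥ (α ∘ₕ β)
    ∘ₕ-assoc : {A B C D : Obj} {f f′ : C ⇒₁ D} {g g′ : B ⇒₁ C} {k k′ : A ⇒₁ B}
               {α : f ⇒₂ f′} {β : g ⇒₂ g′} {γ : k ⇒₂ k′} →
               subst₂ (_⇒₂_ {A} {D}) ⊚-assoc ⊚-assoc ((α ∘ₕ β) ∘ₕ γ) ≡ α ∘ₕ (β ∘ₕ γ)
    ∘ₕ-idˡ : {A B : Obj} {f g : A ⇒₁ B} {α : f ⇒₂ g} →
             subst₂ (_⇒₂_ {A} {B}) ⊚-idˡ ⊚-idˡ (id₂ {f = id₁} ∘ₕ α) ≡ α
    ∘ₕ-idʳ : {A B : Obj} {f g : A ⇒₁ B} {α : f ⇒₂ g} →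
             subst₂ (_⇒₂_ {A} {B}) ⊚-idʳ ⊚-idʳ (α ∘ₕ id₂ {f = id₁}) ≡ α

module Monad-data {o h c : Level} (K : Strict2Category o h c) where
  open Strict2Category K

  module _ {C : Obj} (T : C ⇒₁ C) (μ : (T ⊚ T) ⇒₂ T) (η : id₁ ⇒₂ T) where

    whisker : {F G : C ⇒₁ C} (A : C ⇒₁ C) → F ⇒₂ G → (B : C ⇒₁ C) →
              (A ⊚ (F ⊚ B)) ⇒₂ (A ⊚ (G ⊚ B))
    whisker A φ B = id₂ ∘ₕ (φ ∘ₕ id₂)

    -- Condition (1): the monad laws.
    -- μ ∘ μT and μ ∘ Tμ have domains (TT)T and T(TT), identified via ⊚-assoc;
    -- μ ∘ ηT and μ ∘ Tη have domains IT and TI, identified with T via the unit laws.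
    MonadLaws : Set c
    MonadLaws =
        (μ ∘ᵥ (μ ∘ₕ id₂ {f = T})
           ≡ subst (λ X → X ⇒₂ T) (sym ⊚-assoc) (μ ∘ᵥ (id₂ {f = T} ∘ₕ μ)))
      × (subst (λ X → X ⇒₂ T) ⊚-idˡ (μ ∘ᵥ (η ∘ₕ id₂ {f = T})) ≡ id₂)
      × (subst (λ X → X ⇒₂ T) ⊚-idʳ (μ ∘ᵥ (id₂ {f = T} ∘ₕ η)) ≡ id₂)

    pow : ℕ → C ⇒₁ C
    pow zero    = id₁
    pow (suc n) = T ⊚ pow n

    pow-+ : (a b : ℕ) → pow (a + b) ≡ pow a ⊚ pow b
    pow-+ zero    b = sym ⊚-idˡ
    pow-+ (suc a) b = trans (cong (T ⊚_) (pow-+ a b)) (sym ⊚-assoc)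

    split-μ : (a b : ℕ) → pow (a + (2 + b)) ≡ pow a ⊚ ((T ⊚ T) ⊚ pow b)
    split-μ a b = trans (pow-+ a (2 + b)) (cong (pow a ⊚_) (sym ⊚-assoc))

    split-1 : (a b : ℕ) → pow (a + (1 + b)) ≡ pow a ⊚ (T ⊚ pow b)
    split-1 a b = pow-+ a (1 + b)

    split-0 : (a b : ℕ) → pow (a + b) ≡ pow a ⊚ (id₁ ⊚ pow b)
    split-0 a b = trans (pow-+ a b) (cong (pow a ⊚_) (sym ⊚-idˡ))

    -- Reductions between strings (a string T^n is represented by its length n).
    data Step : ℕ → ℕ → Set where
      μ-step : (a b : ℕ) → Step (a + (2 + b)) (a + (1 + b))
      η-step : (a b : ℕ) → Step (a + b) (a + (1 + b))

    stepValue : {m n : ℕ} → Step m n → pow m ⇒₂ pow n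
    stepValue (μ-step a b) =
      subst₂ _⇒₂_ (sym (split-μ a b)) (sym (split-1 a b)) (whisker (pow a) μ (pow b))
    stepValue (η-step a b) =
      subst₂ _⇒₂_ (sym (split-0 a b)) (sym (split-1 a b)) (whisker (pow a) η (pow b))

    data Derivation : ℕ → ℕ → Set where
      done : {n : ℕ} → Derivation n n
      _▷_  : {l m n : ℕ} → Step l m → Derivation m n → Derivation l n

    value : {m n : ℕ} → Derivation m n → pow m ⇒₂ pow n
    value done       = id₂
    value (s ▷ d)    = value d ∘ᵥ stepValue s

    TTerminal : Set c
    TTerminal =
        ((n : ℕ) → Derivation n 1)
      × ((n : ℕ) (d d′ : Derivation n 1) → value d ≡ value d′)

module Submission where

-- Write collapse n : T^n ⇒ T for the 2-cell that multiplies a string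
-- out from the right (collapse 0 = η, collapse (n+1) = μ ∘ T(collapse n)).
-- (1 ⇒ 2) Under the monad laws every single reduction T^k → T^l is compatible
-- with collapsing, collapse l ∘ (its 2-cell) = collapse k: by induction on the
-- position of the redex, the case of a redex at the head being exactly the
-- associativity resp. left unit law.  Hence every derivation T^n → T has value
-- collapse 1 ∘ value = collapse n, and collapse 1 = μ ∘ Tη = id by the right
-- unit law; so all derivations T^n → T have the value collapse n, and one
-- exists for each n.  (2 ⇒ 1) The three laws are the instances of uniqueness
-- for the pairs of derivations T³ → T and T → T that multiply in the two
-- possible orders, resp. insert a unit and multiply, versus do nothing.

open import Defs
open import Level using (Level; _⊔_)
open import Function.Bundles using (_⇔_; mk⇔)
open import Data.Nat using (ℕ; zero; suc)
open import Data.Product using (_×_; _,_; proj₁; proj₂)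
open import Relation.Binary.PropositionalEquality
  using (_≡_; refl; sym; trans; cong; cong₂; subst; subst₂; module ≡-Reasoning)

module TwoCells {o h c : Level} (K : Strict2Category o h c) where
  open Strict2Category K

  -- α ≋ β: α becomes β after transporting its boundary along equalities of
  -- 1-cells.  The unit and associativity laws of ∘ₕ are equalities in this sense.
  data _≋_ {A B : Obj} {f g f′ g′ : A ⇒₁ B} (α : f ⇒₂ g) (β : f′ ⇒₂ g′) : Set (h ⊔ c) where
    transported : (p : f ≡ f′) (q : g ≡ g′) → subst₂ _⇒₂_ p q α ≡ β → α ≋ β

  infix 4 _≋_

  module _ {A B : Obj} where

    ≡⇒≋ : {f g : A ⇒₁ B} {α β : f ⇒₂ g} → α ≡ β → α ≋ β
    ≡⇒≋ e = transported refl refl e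

    ≋⇒≡ : {f g : A ⇒₁ B} {α β : f ⇒₂ g} → α ≋ β → α ≡ β
    ≋⇒≡ (transported refl refl e) = e

    ≋-refl : {f g : A ⇒₁ B} {α : f ⇒₂ g} → α ≋ α
    ≋-refl = ≡⇒≋ refl

    ≋-sym : {f g f′ g′ : A ⇒₁ B} {α : f ⇒₂ g} {β : f′ ⇒₂ g′} → α ≋ β → β ≋ α
    ≋-sym (transported refl refl refl) = ≋-refl

    ≋-trans : {f g f′ g′ f″ g″ : A ⇒₁ B} {α : f ⇒₂ g} {β : f′ ⇒₂ g′} {γ : f″ ⇒₂ g″} →
              α ≋ β → β ≋ γ → α ≋ γ
    ≋-trans (transported refl refl refl) β≋γ = β≋γ

    subst₂-≋ : {f g f′ g′ : A ⇒₁ B} (p : f ≡ f′) (q : g ≡ g′) (α : f ⇒₂ g) →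
               subst₂ _⇒₂_ p q α ≋ α
    subst₂-≋ refl refl α = ≋-refl

    subst-dom-≋ : {f f′ g : A ⇒₁ B} (p : f ≡ f′) (α : f ⇒₂ g) →
                  subst (λ X → X ⇒₂ g) p α ≋ α
    subst-dom-≋ refl α = ≋-refl

    id₂-≋ : {f f′ : A ⇒₁ B} → f ≡ f′ → id₂ {f = f} ≋ id₂ {f = f′}
    id₂-≋ refl = ≋-refl

    ∘ᵥ-≋ : {f g k f′ g′ k′ : A ⇒₁ B}
           {α : g ⇒₂ k} {β : f ⇒₂ g} {α′ : g′ ⇒₂ k′} {β′ : f′ ⇒₂ g′} →
           α ≋ α′ → β ≋ β′ → α ∘ᵥ β ≋ α′ ∘ᵥ β′
    ∘ᵥ-≋ (transported refl refl refl) (transported refl refl refl) = ≋-refl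

  ∘ₕ-≋ : {A B D : Obj} {f g f′ g′ : B ⇒₁ D} {k l k′ l′ : A ⇒₁ B}
         {α : f ⇒₂ g} {α′ : f′ ⇒₂ g′} {β : k ⇒₂ l} {β′ : k′ ⇒₂ l′} →
         α ≋ α′ → β ≋ β′ → α ∘ₕ β ≋ α′ ∘ₕ β′
  ∘ₕ-≋ (transported refl refl refl) (transported refl refl refl) = ≋-refl

  module ≋-Reasoning where
    infix  1 begin_
    infixr 2 _≋⟨_⟩_ _≋˘⟨_⟩_ _≡⟨_⟩_
    infix  3 _∎

    begin_ : {A B : Obj} {f g f′ g′ : A ⇒₁ B} {α : f ⇒₂ g} {β : f′ ⇒₂ g′} → α ≋ β → α ≋ β
    begin α≋β = α≋β

    _≋⟨_⟩_ : {A B : Obj} {f g f′ g′ f″ g″ : A ⇒₁ B}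
             (α : f ⇒₂ g) {β : f′ ⇒₂ g′} {γ : f″ ⇒₂ g″} → α ≋ β → β ≋ γ → α ≋ γ
    α ≋⟨ α≋β ⟩ β≋γ = ≋-trans α≋β β≋γ

    _≋˘⟨_⟩_ : {A B : Obj} {f g f′ g′ f″ g″ : A ⇒₁ B}
              (α : f ⇒₂ g) {β : f′ ⇒₂ g′} {γ : f″ ⇒₂ g″} → β ≋ α → β ≋ γ → α ≋ γ
    α ≋˘⟨ β≋α ⟩ β≋γ = ≋-trans (≋-sym β≋α) β≋γ

    _≡⟨_⟩_ : {A B : Obj} {f g f″ g″ : A ⇒₁ B}
             (α : f ⇒₂ g) {β : f ⇒₂ g} {γ : f″ ⇒₂ g″} → α ≡ β → β ≋ γ → α ≋ γ
    α ≡⟨ α≡β ⟩ β≋γ = ≋-trans (≡⇒≋ α≡β) β≋γ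

    _∎ : {A B : Obj} {f g : A ⇒₁ B} (α : f ⇒₂ g) → α ≋ α
    α ∎ = ≋-refl

  ∘ₕ-idˡ-≋ : {A B : Obj} {f g : A ⇒₁ B} (α : f ⇒₂ g) → id₂ {f = id₁} ∘ₕ α ≋ α
  ∘ₕ-idˡ-≋ α = ≋-trans (≋-sym (subst₂-≋ ⊚-idˡ ⊚-idˡ _)) (≡⇒≋ ∘ₕ-idˡ)

  ∘ₕ-idʳ-≋ : {A B : Obj} {f g : A ⇒₁ B} (α : f ⇒₂ g) → α ∘ₕ id₂ {f = id₁} ≋ α
  ∘ₕ-idʳ-≋ α = ≋-trans (≋-sym (subst₂-≋ ⊚-idʳ ⊚-idʳ _)) (≡⇒≋ ∘ₕ-idʳ)

  ∘ₕ-assoc-≋ : {A B C D : Obj} {f f′ : C ⇒₁ D} {g g′ : B ⇒₁ C} {k k′ : A ⇒₁ B}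
               (α : f ⇒₂ f′) (β : g ⇒₂ g′) (γ : k ⇒₂ k′) → (α ∘ₕ β) ∘ₕ γ ≋ α ∘ₕ (β ∘ₕ γ)
  ∘ₕ-assoc-≋ α β γ = ≋-trans (≋-sym (subst₂-≋ ⊚-assoc ⊚-assoc _)) (≡⇒≋ ∘ₕ-assoc)

  whisker-⊚ : {A B C D : Obj} {f : C ⇒₁ D} {g : B ⇒₁ C} {k l : A ⇒₁ B} (α : k ⇒₂ l) →
              id₂ {f = f ⊚ g} ∘ₕ α ≋ id₂ {f = f} ∘ₕ (id₂ {f = g} ∘ₕ α)
  whisker-⊚ α = ≋-trans (≡⇒≋ (cong (_∘ₕ α) (sym ∘ₕ-id))) (∘ₕ-assoc-≋ id₂ id₂ α)

  whisker-∘ᵥ : {A B C : Obj} {f : B ⇒₁ C} {k l m : A ⇒₁ B} (α : l ⇒₂ m) (β : k ⇒₂ l) →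
               (id₂ {f = f} ∘ₕ α) ∘ᵥ (id₂ {f = f} ∘ₕ β) ≡ id₂ {f = f} ∘ₕ (α ∘ᵥ β)
  whisker-∘ᵥ α β = trans (sym interchange) (cong (_∘ₕ (α ∘ᵥ β)) ∘ᵥ-idˡ)

  slide : {A B C : Obj} {f f′ : B ⇒₁ C} {k k′ : A ⇒₁ B} (α : f ⇒₂ f′) (β : k ⇒₂ k′) →
          (id₂ {f = f′} ∘ₕ β) ∘ᵥ (α ∘ₕ id₂ {f = k}) ≡ (α ∘ₕ id₂ {f = k′}) ∘ᵥ (id₂ {f = f} ∘ₕ β)
  slide α β = begin
    (id₂ ∘ₕ β) ∘ᵥ (α ∘ₕ id₂)   ≡⟨ sym interchange ⟩
    (id₂ ∘ᵥ α) ∘ₕ (β ∘ᵥ id₂)   ≡⟨ cong₂ _∘ₕ_ (trans ∘ᵥ-idˡ (sym ∘ᵥ-idʳ)) (trans ∘ᵥ-idʳ (sym ∘ᵥ-idˡ)) ⟩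
    (α ∘ᵥ id₂) ∘ₕ (id₂ ∘ᵥ β)   ≡⟨ interchange ⟩
    (α ∘ₕ id₂) ∘ᵥ (id₂ ∘ₕ β)   ∎
    where open ≡-Reasoning

module RewriteCategory {o h c : Level} (K : Strict2Category o h c) where
  open Strict2Category K
  open Monad-data K
  open TwoCells K

  module _ {C : Obj} (T : C ⇒₁ C) (μ : (T ⊚ T) ⇒₂ T) (η : id₁ ⇒₂ T) where

    P : ℕ → C ⇒₁ C
    P = pow T μ η

    ⟦_⟧ₛ : {k l : ℕ} → Step T μ η k l → P k ⇒₂ P l
    ⟦_⟧ₛ = stepValue T μ η

    ⟦_⟧ : {k l : ℕ} → Derivation T μ η k l → P k ⇒₂ P l
    ⟦_⟧ = value T μ η

    whiskerAt : {F G : C ⇒₁ C} (a : ℕ) → F ⇒₂ G → (b : ℕ) →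
                (P a ⊚ (F ⊚ P b)) ⇒₂ (P a ⊚ (G ⊚ P b))
    whiskerAt a φ b = whisker T μ η (P a) φ (P b)

    MonadLaws≋ : Set (h ⊔ c)
    MonadLaws≋ =
        (μ ∘ᵥ (μ ∘ₕ id₂ {f = T}) ≋ μ ∘ᵥ (id₂ {f = T} ∘ₕ μ))
      × (μ ∘ᵥ (η ∘ₕ id₂ {f = T}) ≋ id₂ {f = T})
      × (μ ∘ᵥ (id₂ {f = T} ∘ₕ η) ≋ id₂ {f = T})

    laws⇒≋ : MonadLaws T μ η → MonadLaws≋
    laws⇒≋ (assoc , unitˡ , unitʳ) =
        ≋-trans (≡⇒≋ assoc) (subst-dom-≋ _ _)
      , ≋-trans (≋-sym (subst-dom-≋ _ _)) (≡⇒≋ unitˡ)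
      , ≋-trans (≋-sym (subst-dom-≋ _ _)) (≡⇒≋ unitʳ)

    ≋⇒laws : MonadLaws≋ → MonadLaws T μ η
    ≋⇒laws (assoc , unitˡ , unitʳ) =
        ≋⇒≡ (≋-trans assoc (≋-sym (subst-dom-≋ _ _)))
      , ≋⇒≡ (≋-trans (subst-dom-≋ _ _) unitˡ)
      , ≋⇒≡ (≋-trans (subst-dom-≋ _ _) unitʳ)

    μ-step-≋ : (a b : ℕ) → ⟦ μ-step a b ⟧ₛ ≋ whiskerAt a μ b
    μ-step-≋ a b = subst₂-≋ _ _ _

    η-step-≋ : (a b : ℕ) → ⟦ η-step a b ⟧ₛ ≋ whiskerAt a η b
    η-step-≋ a b = subst₂-≋ _ _ _

    -- The string T¹ is T I, whose identity is that of T up to transport.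
    id-T¹ : id₂ {f = P 1} ≋ id₂ {f = T}
    id-T¹ = id₂-≋ ⊚-idʳ

    whiskerAt-zero : {F G : C ⇒₁ C} (φ : F ⇒₂ G) (b : ℕ) → whiskerAt 0 φ b ≋ φ ∘ₕ id₂ {f = P b}
    whiskerAt-zero φ b = ∘ₕ-idˡ-≋ _

    whiskerAt-suc : {F G : C ⇒₁ C} (a : ℕ) (φ : F ⇒₂ G) (b : ℕ) →
                    whiskerAt (suc a) φ b ≋ id₂ {f = T} ∘ₕ whiskerAt a φ b
    whiskerAt-suc a φ b = whisker-⊚ _

    shift : {k l : ℕ} → Step T μ η k l → Step T μ η (suc k) (suc l)
    shift (μ-step a b) = μ-step (suc a) b
    shift (η-step a b) = η-step (suc a) b

    ⟦shift⟧ : {k l : ℕ} (s : Step T μ η k l) → ⟦ shift s ⟧ₛ ≡ id₂ {f = T} ∘ₕ ⟦ s ⟧ₛ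
    ⟦shift⟧ (μ-step a b) = ≋⇒≡ (≋-trans (μ-step-≋ (suc a) b)
      (≋-trans (whiskerAt-suc a μ b) (∘ₕ-≋ ≋-refl (≋-sym (μ-step-≋ a b)))))
    ⟦shift⟧ (η-step a b) = ≋⇒≡ (≋-trans (η-step-≋ (suc a) b)
      (≋-trans (whiskerAt-suc a η b) (∘ₕ-≋ ≋-refl (≋-sym (η-step-≋ a b)))))

    collapse : (n : ℕ) → P n ⇒₂ T
    collapse zero    = η
    collapse (suc n) = μ ∘ᵥ (id₂ {f = T} ∘ₕ collapse n)

    Compatible : (k l : ℕ) → P k ⇒₂ P l → Set c
    Compatible k l S = collapse l ∘ᵥ S ≡ collapse k

    compatible-shift : {k l : ℕ} (s : Step T μ η k l) →
                       Compatible k l ⟦ s ⟧ₛ → Compatible (suc k) (suc l) ⟦ shift s ⟧ₛ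
    compatible-shift {k} {l} s compatible = begin
      (μ ∘ᵥ (id₂ ∘ₕ collapse l)) ∘ᵥ ⟦ shift s ⟧ₛ      ≡⟨ cong (_ ∘ᵥ_) (⟦shift⟧ s) ⟩
      (μ ∘ᵥ (id₂ ∘ₕ collapse l)) ∘ᵥ (id₂ ∘ₕ ⟦ s ⟧ₛ)   ≡⟨ ∘ᵥ-assoc ⟩
      μ ∘ᵥ ((id₂ ∘ₕ collapse l) ∘ᵥ (id₂ ∘ₕ ⟦ s ⟧ₛ))   ≡⟨ cong (μ ∘ᵥ_) (whisker-∘ᵥ _ _) ⟩
      μ ∘ᵥ (id₂ ∘ₕ (collapse l ∘ᵥ ⟦ s ⟧ₛ))           ≡⟨ cong (λ α → μ ∘ᵥ (id₂ ∘ₕ α)) compatible ⟩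
      μ ∘ᵥ (id₂ ∘ₕ collapse k)                       ∎
      where open ≡-Reasoning

    collapse-head : {F : C ⇒₁ C} (φ : F ⇒₂ T) (b : ℕ) →
                    collapse (suc b) ∘ᵥ (φ ∘ₕ id₂ {f = P b})
                      ≡ (μ ∘ᵥ (φ ∘ₕ id₂ {f = T})) ∘ᵥ (id₂ {f = F} ∘ₕ collapse b)
    collapse-head φ b = begin
      (μ ∘ᵥ (id₂ ∘ₕ collapse b)) ∘ᵥ (φ ∘ₕ id₂)   ≡⟨ ∘ᵥ-assoc ⟩
      μ ∘ᵥ ((id₂ ∘ₕ collapse b) ∘ᵥ (φ ∘ₕ id₂))   ≡⟨ cong (μ ∘ᵥ_) (slide φ (collapse b)) ⟩
      μ ∘ᵥ ((φ ∘ₕ id₂) ∘ᵥ (id₂ ∘ₕ collapse b))   ≡⟨ sym ∘ᵥ-assoc ⟩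
      (μ ∘ᵥ (φ ∘ₕ id₂)) ∘ᵥ (id₂ ∘ₕ collapse b)   ∎
      where open ≡-Reasoning

    module UnderMonadLaws (laws : MonadLaws≋) where

      assoc : μ ∘ᵥ (μ ∘ₕ id₂ {f = T}) ≋ μ ∘ᵥ (id₂ {f = T} ∘ₕ μ)
      assoc = proj₁ laws

      unitˡ : μ ∘ᵥ (η ∘ₕ id₂ {f = T}) ≋ id₂ {f = T}
      unitˡ = proj₁ (proj₂ laws)

      -- The right unit law says that collapsing a one-letter string is the identity.
      collapse-one : collapse 1 ≋ id₂ {f = T}
      collapse-one = proj₂ (proj₂ laws)

      -- Associativity: a multiplication at the head is compatible.
      μ-head : (b : ℕ) → collapse (suc b) ∘ᵥ (μ ∘ₕ id₂ {f = P b}) ≋ collapse (suc (suc b))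
      μ-head b = begin
        collapse (suc b) ∘ᵥ (μ ∘ₕ id₂)                  ≡⟨ collapse-head μ b ⟩
        (μ ∘ᵥ (μ ∘ₕ id₂)) ∘ᵥ (id₂ {f = T ⊚ T} ∘ₕ collapse b)
          ≋⟨ ∘ᵥ-≋ assoc (whisker-⊚ (collapse b)) ⟩
        (μ ∘ᵥ (id₂ ∘ₕ μ)) ∘ᵥ (id₂ ∘ₕ (id₂ ∘ₕ collapse b)) ≡⟨ ∘ᵥ-assoc ⟩
        μ ∘ᵥ ((id₂ ∘ₕ μ) ∘ᵥ (id₂ ∘ₕ (id₂ ∘ₕ collapse b))) ≡⟨ cong (μ ∘ᵥ_) (whisker-∘ᵥ _ _) ⟩
        collapse (suc (suc b))                          ∎
        where open ≋-Reasoning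

      -- Left unit: inserting a unit at the head is compatible.
      η-head : (b : ℕ) → collapse (suc b) ∘ᵥ (η ∘ₕ id₂ {f = P b}) ≋ collapse b
      η-head b = begin
        collapse (suc b) ∘ᵥ (η ∘ₕ id₂)                     ≡⟨ collapse-head η b ⟩
        (μ ∘ᵥ (η ∘ₕ id₂)) ∘ᵥ (id₂ {f = id₁} ∘ₕ collapse b) ≋⟨ ∘ᵥ-≋ unitˡ (∘ₕ-idˡ-≋ _) ⟩
        id₂ ∘ᵥ collapse b                                  ≡⟨ ∘ᵥ-idˡ ⟩
        collapse b                                         ∎
        where open ≋-Reasoning

      step-compatible : {k l : ℕ} (s : Step T μ η k l) → Compatible k l ⟦ s ⟧ₛ
      step-compatible (μ-step zero b) =
        ≋⇒≡ (≋-trans (∘ᵥ-≋ ≋-refl (≋-trans (μ-step-≋ 0 b) (whiskerAt-zero μ b))) (μ-head b))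
      step-compatible (η-step zero b) =
        ≋⇒≡ (≋-trans (∘ᵥ-≋ ≋-refl (≋-trans (η-step-≋ 0 b) (whiskerAt-zero η b))) (η-head b))
      step-compatible (μ-step (suc a) b) = compatible-shift (μ-step a b) (step-compatible (μ-step a b))
      step-compatible (η-step (suc a) b) = compatible-shift (η-step a b) (step-compatible (η-step a b))

      value-compatible : {k l : ℕ} (d : Derivation T μ η k l) → Compatible k l ⟦ d ⟧
      value-compatible done    = ∘ᵥ-idʳ
      value-compatible {k} {l} (_▷_ {m = m} s d) = begin
        collapse l ∘ᵥ (⟦ d ⟧ ∘ᵥ ⟦ s ⟧ₛ)   ≡⟨ sym ∘ᵥ-assoc ⟩
        (collapse l ∘ᵥ ⟦ d ⟧) ∘ᵥ ⟦ s ⟧ₛ   ≡⟨ cong (_∘ᵥ ⟦ s ⟧ₛ) (value-compatible d) ⟩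
        collapse m ∘ᵥ ⟦ s ⟧ₛ              ≡⟨ step-compatible s ⟩
        collapse k                        ∎
        where open ≡-Reasoning

      value-unique : {n : ℕ} (d : Derivation T μ η n 1) → ⟦ d ⟧ ≋ collapse n
      value-unique {n} d = begin
        ⟦ d ⟧                 ≡⟨ sym ∘ᵥ-idˡ ⟩
        id₂ ∘ᵥ ⟦ d ⟧          ≋⟨ ∘ᵥ-≋ (≋-trans id-T¹ (≋-sym collapse-one)) ≋-refl ⟩
        collapse 1 ∘ᵥ ⟦ d ⟧   ≡⟨ value-compatible d ⟩
        collapse n            ∎
        where open ≋-Reasoning

    reduceToT : (n : ℕ) → Derivation T μ η n 1
    reduceToT zero          = η-step 0 0 ▷ done
    reduceToT (suc zero)    = done
    reduceToT (suc (suc n)) = μ-step 0 n ▷ reduceToT (suc n)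

    laws⇒terminal : MonadLaws T μ η → TTerminal T μ η
    laws⇒terminal laws = reduceToT , λ n d d′ →
      ≋⇒≡ (≋-trans (value-unique d) (≋-sym (value-unique d′)))
      where open UnderMonadLaws (laws⇒≋ laws)

    multiply : Derivation T μ η 2 1
    multiply = μ-step 0 0 ▷ done

    then-multiply : {k : ℕ} (s : Step T μ η k 2) {F : C ⇒₁ C} {α : F ⇒₂ (T ⊚ T)} →
                    ⟦ s ⟧ₛ ≋ α → ⟦ s ▷ multiply ⟧ ≋ μ ∘ᵥ α
    then-multiply s s≋α = ∘ᵥ-≋ ⟦multiply⟧ s≋α
      where
        ⟦multiply⟧ : ⟦ multiply ⟧ ≋ μ
        ⟦multiply⟧ = ≋-trans (≡⇒≋ ∘ᵥ-idˡ)
          (≋-trans (μ-step-≋ 0 0) (≋-trans (whiskerAt-zero μ 0) (∘ₕ-idʳ-≋ μ)))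

    whiskerAt-0-1 : {F : C ⇒₁ C} (φ : F ⇒₂ T) → whiskerAt 0 φ 1 ≋ φ ∘ₕ id₂ {f = T}
    whiskerAt-0-1 φ = ≋-trans (whiskerAt-zero φ 1) (∘ₕ-≋ ≋-refl id-T¹)

    whiskerAt-1-0 : {F : C ⇒₁ C} (φ : F ⇒₂ T) → whiskerAt 1 φ 0 ≋ id₂ {f = T} ∘ₕ φ
    whiskerAt-1-0 φ = ≋-trans (whiskerAt-suc 0 φ 0)
      (∘ₕ-≋ ≋-refl (≋-trans (whiskerAt-zero φ 0) (∘ₕ-idʳ-≋ φ)))

    -- Each law compares the values of two derivations with the same endpoints.
    terminal⇒laws : TTerminal T μ η → MonadLaws T μ η
    terminal⇒laws (_ , unique) = ≋⇒laws (assoc , unitˡ , unitʳ)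
      where
        open ≋-Reasoning

        assoc : μ ∘ᵥ (μ ∘ₕ id₂ {f = T}) ≋ μ ∘ᵥ (id₂ {f = T} ∘ₕ μ)
        assoc = begin
          μ ∘ᵥ (μ ∘ₕ id₂)             ≋˘⟨ then-multiply (μ-step 0 1) (≋-trans (μ-step-≋ 0 1) (whiskerAt-0-1 μ)) ⟩
          ⟦ μ-step 0 1 ▷ multiply ⟧   ≡⟨ unique 3 (μ-step 0 1 ▷ multiply) (μ-step 1 0 ▷ multiply) ⟩
          ⟦ μ-step 1 0 ▷ multiply ⟧   ≋⟨ then-multiply (μ-step 1 0) (≋-trans (μ-step-≋ 1 0) (whiskerAt-1-0 μ)) ⟩
          μ ∘ᵥ (id₂ ∘ₕ μ)             ∎

        unitˡ : μ ∘ᵥ (η ∘ₕ id₂ {f = T}) ≋ id₂ {f = T}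
        unitˡ = begin
          μ ∘ᵥ (η ∘ₕ id₂)             ≋˘⟨ then-multiply (η-step 0 1) (≋-trans (η-step-≋ 0 1) (whiskerAt-0-1 η)) ⟩
          ⟦ η-step 0 1 ▷ multiply ⟧   ≡⟨ unique 1 (η-step 0 1 ▷ multiply) done ⟩
          id₂                         ≋⟨ id-T¹ ⟩
          id₂                         ∎

        unitʳ : μ ∘ᵥ (id₂ {f = T} ∘ₕ η) ≋ id₂ {f = T}
        unitʳ = begin
          μ ∘ᵥ (id₂ ∘ₕ η)             ≋˘⟨ then-multiply (η-step 1 0) (≋-trans (η-step-≋ 1 0) (whiskerAt-1-0 η)) ⟩
          ⟦ η-step 1 0 ▷ multiply ⟧   ≡⟨ unique 1 (η-step 1 0 ▷ multiply) done ⟩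
          id₂                         ≋⟨ id-T¹ ⟩
          id₂                         ∎

theorem4p2 : {o h c : Level} (K : Strict2Category o h c) →
    let open Strict2Category K in
    {C : Obj} (T : C ⇒₁ C) (μ : (T ⊚ T) ⇒₂ T) (η : id₁ ⇒₂ T) →
    Monad-data.MonadLaws K T μ η ⇔ Monad-data.TTerminal K T μ η
theorem4p2 K T μ η =
  mk⇔ (RewriteCategory.laws⇒terminal K T μ η) (RewriteCategory.terminal⇒laws K T μ η)
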